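{- Let $T$ be a tree with $n\ge2$ vertices $v_1,\dots,v_n$ in which $v_n$ is a leaf adjacent to $v_{n-1}$. Let $t\in\{1,\dots,n-1\}$, $\ell\ge n$, and let $\nu\in\mathbb{Z}_{\ge0}^{n-1}$ be a near-minimally self-reachable configuration on $T\setminus v_n$ about $v_t$ with $\ell$ chips. Then: (1) if $t\ne n-1$, both $(\nu+e_{n-1},0)$ and $(\nu,1)$ are near-minimally self-reachable configurations on $T$ about $v_t$ with $\ell+1$ chips; (2) if $t=n-1$, then for every integer $L\ge1$, $(\nu+Le_{n-1},0)$ is a near-minimally self-reachable configuration on $T$ about $v_{n-1}$ with $\ell+L$ chips.
   Context: $e_i$ denotes the $i$th standard basis vector (of $\mathbb{Z}^{n-1}$ here), and $(x,y)$ denotes the vector in $\mathbb{Z}^n$ obtained by appending the entry $y$ to $x\in\mathbb{Z}^{n-1}$; $T\setminus v_n$ is the tree on $v_1,\dots,v_{n-1}$. A chip configuration on a tree is a vector of nonnegative integers indexed by its vertices. For a tree $G$ with Laplacian $\Delta(G)$ ($\Delta_{ii}=\deg(v_i)$, $\Delta_{ij}=-1$ for edges, $0$ otherwise), firing $v_i$ from $c$ produces $c-\Delta(G)e_i$, legal if $c_i\ge\deg(v_i)$. A configuration is self-reachable on $G$ if some nonempty finite sequence of legal firings starting from it returns to it. (Known: equivalently, it has at least $m-1$ chips on every $m$-vertex subtree.) On an $m$-vertex tree, a configuration is minimally self-reachable if self-reachable with exactly $m-1$ chips. A configuration $\nu$ is near-minimally self-reachable on $G$ if it is self-reachable and not minimally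 self-reachable, and there is a unique $i$ with $\nu-e_i$ self-reachable on $G$; it is then near-minimally self-reachable about $v_i$. -}

module Defs where

open import Data.Nat using (ℕ; zero; suc; _+_; _∸_; _≤_)
open import Data.Bool using (Bool; true; false; if_then_else_; _∧_; _∨_; not)
open import Data.Fin using (Fin; zero; suc; _≟_; inject₁; fromℕ)
open import Data.List using (List; []; _∷_; map; allFin)
open import Data.Nat.ListAction using (sum)
open import Data.Product using (Σ; _×_; _,_; ∃)
open import Relation.Nullary using (¬_; does)
open import Relation.Binary.PropositionalEquality using (_≡_; _≢_)

Graph : ℕ → Set
Graph n = Fin n → Fin n → Bool

_==_ : ∀ {n} → Fin n → Fin n → Bool
x == y = does (x ≟ y)

data Connected {n} (G : Graph n) : Fin n → Fin n → Set where
  here : ∀ {u} → Connected G u u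
  step : ∀ {u w v} → G u w ≡ true → Connected G w v → Connected G u v

deleteEdge : ∀ {n} → Graph n → Fin n → Fin n → Graph n
deleteEdge G u v x y =
  G x y ∧ not ((x == u ∧ y == v) ∨ (x == v ∧ y == u))

-- A tree: a simple graph (symmetric, loopless) which is connected and
-- minimally connected (removing any edge disconnects its endpoints),
-- i.e. connected and acyclic.
record IsTree {n} (G : Graph n) : Set where
  field
    symmetric   : ∀ u v → G u v ≡ G v u
    loopless    : ∀ u → G u u ≡ false
    connected   : ∀ u v → Connected G u v
    edgeBridges : ∀ u v → G u v ≡ true → ¬ Connected (deleteEdge G u v) u v

deleteLast : ∀ {m} → Graph (suc m) → Graph m
deleteLast G x y = G (inject₁ x) (inject₁ y)

Config : ℕ → Set
Config n = Fin n → ℕ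

b2n : Bool → ℕ
b2n true  = 1
b2n false = 0

deg : ∀ {n} → Graph n → Fin n → ℕ
deg {n} G i = sum (map (λ j → b2n (G i j)) (allFin n))

total : ∀ {n} → Config n → ℕ
total {n} c = sum (map c (allFin n))

-- c - Δ(G) e_i  (only used when the firing is legal, so ∸ is exact)
fire : ∀ {n} → Graph n → Fin n → Config n → Config n
fire G i c j =
  if i == j then c j ∸ deg G i
  else (if G i j then suc (c j) else c j)

data Runs {n} (G : Graph n) : Config n → List (Fin n) → Config n → Set where
  done : ∀ {c d} → (∀ j → c j ≡ d j) → Runs G c [] d
  step : ∀ {c i is d} → deg G i ≤ c i → Runs G (fire G i c) is d → Runs G c (i ∷ is) d

SelfReachable : ∀ {n} → Graph n → Config n → Set
SelfReachable {n} G c = Σ (Fin n) λ i → Σ (List (Fin n)) λ is → Runs G c (i ∷ is) c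

MinSelfReachable : ∀ {n} → Graph n → Config n → Set
MinSelfReachable {n} G c = SelfReachable G c × suc (total c) ≡ n

-- c - e_i (used only when c i ≥ 1)
minusE : ∀ {n} → Config n → Fin n → Config n
minusE c i j = if i == j then c j ∸ 1 else c j

plusE : ∀ {n} → Config n → Fin n → ℕ → Config n
plusE c i L j = if i == j then c j + L else c j

DecSR : ∀ {n} → Graph n → Config n → Fin n → Set
DecSR G c i = 1 ≤ c i × SelfReachable G (minusE c i)

NearMinSRAbout : ∀ {n} → Graph n → Config n → Fin n → Set
NearMinSRAbout G c t =
  SelfReachable G c × ¬ MinSelfReachable G c × DecSR G c t
  × (∀ j → DecSR G c j → j ≡ t)

snoc : ∀ {m} → Config m → ℕ → Config (suc m)
snoc {zero}  x y zero    = y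
snoc {suc m} x y zero    = x zero
snoc {suc m} x y (suc j) = snoc (λ k → x (suc k)) y j

{-# OPTIONS --safe #-}
module Submission where

-- Write P = v_{n-1} and H = T ∖ v_n.  Contracting the leaf edge {P, v_n} turns a configuration c
-- on T into the configuration on H with c(P) + c(v_n) − 1 chips at P.  While the edge carries a
-- chip, legal firings on either side simulate each other (firing P in H becomes firing v_n and P
-- in T, in the order that restores the leaf), so for c(v_n) ≤ 1, c is self-reachable on T iff its
-- contraction is on H, and a decrement of c descends to one of its contraction.  The
-- configurations of the lemma contract to ν or to ν + (L − 1) e_{n-1}; this gives everything but
-- uniqueness in case (2), where a decrement at a ≠ P only makes ν − e_a + (L − 1) e_{n-1}
-- self-reachable.  A configuration on a connected graph is self-reachable iff no nonempty vertex
-- set U is stuck (every u ∈ U has fewer chips than neighbours in U).  On the tree H a stuck set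
-- for ν − e_a must contain P, and then the self-reachable ν − e_P forces a cycle through P; so
-- ν − e_a is self-reachable, against uniqueness for ν.

open import Defs
open import Data.Nat using (ℕ; suc; _+_; _≤_)
open import Data.Fin using (Fin; inject₁; fromℕ)
open import Data.Product using (_×_)
open import Data.Bool using (true)
open import Relation.Binary.PropositionalEquality using (_≡_; _≢_)

open import Data.Bool using (Bool; false; _∧_; _∨_; not; if_then_else_)
open import Data.Bool.Properties
  using (∧-comm; ∧-zeroʳ; ∧-identityʳ; ∧-conicalˡ; ∧-conicalʳ; ∨-zeroʳ; ∨-identityʳ)
  renaming (_≟_ to _≟ᵇ_)
open import Data.Empty using (⊥; ⊥-elim)
open import Data.Fin using (zero; suc; punchIn; punchOut; pinch; _≟_)
open import Data.Fin.Properties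
  using (suc-injective; inject₁-injective; fromℕ≢inject₁; punchInᵢ≢i; punchIn-punchOut)
import Data.Fin.Properties as Fin
open import Data.Fin.Relation.Unary.Top using (view; ‵fromℕ; ‵inj₁)
open import Data.List using (List; []; _∷_; map; allFin; tabulate; length)
open import Data.List.Membership.Propositional using (_∈_; _∉_)
open import Data.List.Properties using (map-tabulate)
open import Data.List.Relation.Unary.Any using (any?; here; there)
open import Data.Nat using (zero; _∸_; _<_; z≤n; s≤s; s≤s⁻¹; _≤?_)
import Data.Nat.ListAction as List
open import Data.Nat.Properties
  using ( +-assoc; +-comm; +-suc; +-identityʳ; +-mono-≤; +-monoʳ-≤; +-monoˡ-≤
        ; +-cancelˡ-≤; +-cancelʳ-<; +-cancelʳ-≡; +-∸-assoc; +-∸-comm; ∸-+-assoc; ∸-monoˡ-≤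
        ; m+[n∸m]≡n; m+n∸n≡m; m∸n+n≡m; m<m+n; m≤m+n; m≤n+m; m≤n⇒m≤1+n; n<1+n; n≤1⇒n≡0∨n≡1
        ; <⇒≢; <⇒≱; ≰⇒>; ≤-pred; ≤-refl; ≤-reflexive; ≤-trans; module ≤-Reasoning
        ; +-0-commutativeMonoid )
open import Algebra.Properties.CommutativeMonoid.Sum +-0-commutativeMonoid
  using (sum; sum-cong-≗; ∑-distrib-+; sum-remove; sum-replicate-zero; sum-init-last)
open import Data.Product using (∃; ∃₂; _,_; proj₁; proj₂)
open import Data.Sum using (_⊎_; inj₁; inj₂)
import Data.Sum as Sum
open import Data.Vec.Functional using (removeAt)
open import Function using (_∘_; id; _$_)
open import Relation.Nullary using (¬_; Dec; yes; no; does; ¬?; contradiction)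
open import Relation.Nullary.Decidable using (dec-true; dec-false; _×-dec_; decidable-stable)
open import Relation.Binary.PropositionalEquality
  using (refl; sym; trans; cong; cong₂; subst; subst₂; _≗_; module ≡-Reasoning)

private
  variable
    n n′ : ℕ

-- Finite sums and vertex sets

==-refl : (x : Fin n) → (x == x) ≡ true
==-refl x = dec-true (x ≟ x) refl

==-≢ : {x y : Fin n} → x ≢ y → (x == y) ≡ false
==-≢ {x = x} {y} = dec-false (x ≟ y)

==⇒≡ : {x y : Fin n} → (x == y) ≡ true → x ≡ y
==⇒≡ {x = x} {y} eq with x ≟ y
... | yes x≡y = x≡y

split-at : {P : Fin n → Set} (q : Fin n) → P q → (∀ i → i ≢ q → P i) → ∀ i → P i
split-at q at-q elsewhere i with i ≟ q
... | yes refl = at-q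
... | no  i≢q  = elsewhere i i≢q

sum-allFin : (f : Fin n → ℕ) → List.sum (map f (allFin n)) ≡ sum f
sum-allFin {n} f = trans (cong List.sum (map-tabulate id f)) (sum-tabulate n f)
  where
  sum-tabulate : ∀ n (f : Fin n → ℕ) → List.sum (tabulate f) ≡ sum f
  sum-tabulate zero    f = refl
  sum-tabulate (suc n) f = cong (f zero +_) (sum-tabulate n (f ∘ suc))

sum-mono-≤ : {f g : Fin n → ℕ} → (∀ i → f i ≤ g i) → sum f ≤ sum g
sum-mono-≤ {zero}  f≤g = z≤n
sum-mono-≤ {suc n} f≤g = +-mono-≤ (f≤g zero) (sum-mono-≤ (f≤g ∘ suc))

≤-sum : (f : Fin n → ℕ) (i : Fin n) → f i ≤ sum f
≤-sum {suc n} f i = ≤-trans (m≤m+n (f i) _) (≤-reflexive (sym (sum-remove {i = i} f)))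

sum-single : {f : Fin n → ℕ} (i : Fin n) → (∀ j → j ≢ i → f j ≡ 0) → sum f ≡ f i
sum-single {suc n} {f} i rest = begin
  sum f                                      ≡⟨ sum-remove {i = i} f ⟩
  f i + sum (λ j → f (punchIn i j))          ≡⟨ cong (f i +_) (sum-cong-≗ {n} (λ j → rest _ (punchInᵢ≢i i j))) ⟩
  f i + sum {n} (λ _ → 0)                    ≡⟨ cong (f i +_) (sum-replicate-zero n) ⟩
  f i + 0                                    ≡⟨ +-identityʳ (f i) ⟩
  f i                                        ∎
  where open ≡-Reasoning

sum-witness : (f : Fin n → ℕ) → 1 ≤ sum f → ∃ λ i → 1 ≤ f i
sum-witness {suc n} f 1≤Σf with f zero in eq
... | suc _ = zero , subst (1 ≤_) (sym eq) (s≤s z≤n)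
... | zero  = let i , 1≤fi = sum-witness (f ∘ suc) 1≤Σf in suc i , 1≤fi

VertexSet : ℕ → Set
VertexSet n = Fin n → Bool

_⊆_ : VertexSet n → VertexSet n → Set
S ⊆ S′ = ∀ w → S w ≡ true → S′ w ≡ true

_∩_ _∖_ : VertexSet n → VertexSet n → VertexSet n
(S ∩ S′) w = S w ∧ S′ w
(S ∖ S′) w = S w ∧ not (S′ w)

∁ : VertexSet n → VertexSet n
∁ S = (λ _ → true) ∖ S

insert : Fin n → VertexSet n → VertexSet n
insert v S w = S w ∨ (w == v)

insert-self : (S : VertexSet n) (v : Fin n) → insert v S v ≡ true
insert-self S v rewrite ==-refl v = ∨-zeroʳ (S v)

insert-other : (S : VertexSet n) {v w : Fin n} → v ≢ w → insert v S w ≡ S w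
insert-other S {v} {w} v≢w rewrite ==-≢ (v≢w ∘ sym) = ∨-identityʳ (S w)

insert-⊇ : (S : VertexSet n) (v : Fin n) {w : Fin n} → S w ≡ true → insert v S w ≡ true
insert-⊇ S v {w} Sw = cong (_∨ (w == v)) Sw

insert-true : {S : VertexSet n} {v w : Fin n} → insert v S w ≡ true → S w ≡ true ⊎ w ≡ v
insert-true {S = S} {v} {w} e with S w
... | true  = inj₁ refl
... | false = inj₂ (==⇒≡ e)

module _ (U R : VertexSet n) {w : Fin n} where

  ∈-∖ : U w ≡ true → R w ≡ false → (U ∖ R) w ≡ true
  ∈-∖ Uw Rw rewrite Uw | Rw = refl

  ∈-∖⁻ : (U ∖ R) w ≡ true → U w ≡ true × R w ≡ false
  ∈-∖⁻ e with U w | R w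
  ... | true | false = refl , refl

∖-insert : (U R : VertexSet n) (v : Fin n) → (U ∖ insert v R) ⊆ (U ∖ R)
∖-insert U R v w e with U w | R w
... | true | false = refl

∉-∖-insert : (U R : VertexSet n) (v : Fin n) → (U ∖ insert v R) v ≡ false
∉-∖-insert U R v rewrite insert-self R v = ∧-zeroʳ (U v)

size : VertexSet n → ℕ
size S = sum (b2n ∘ S)

b2n-true : ∀ {b} → 1 ≤ b2n b → b ≡ true
b2n-true {true} _ = refl

size-witness : (S : VertexSet n) → 1 ≤ size S → ∃ λ w → S w ≡ true
size-witness S 1≤|S| = let w , 1≤Sw = sum-witness (b2n ∘ S) 1≤|S| in w , b2n-true 1≤Sw

size-witness₂ : (S : VertexSet n) → 2 ≤ size S → ∃₂ λ v w → v ≢ w × S v ≡ true × S w ≡ true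
size-witness₂ {suc n} S 2≤|S| with S zero in eq
... | true  = let w , Sw = size-witness (S ∘ suc) (s≤s⁻¹ 2≤|S|) in zero , suc w , (λ ()) , eq , Sw
... | false = let v , w , v≢w , Sv , Sw = size-witness₂ (S ∘ suc) 2≤|S|
              in suc v , suc w , v≢w ∘ suc-injective , Sv , Sw

size-pos : {S : VertexSet n} {v : Fin n} → S v ≡ true → 1 ≤ size S
size-pos {S = S} {v} Sv = ≤-trans (≤-reflexive (cong b2n (sym Sv))) (≤-sum (b2n ∘ S) v)

size-two : {S : VertexSet n} {v w : Fin n} → v ≢ w → S v ≡ true → S w ≡ true → 2 ≤ size S
size-two {suc n} {S} {v} {w} v≢w Sv Sw = begin
  2                                          ≡⟨ cong₂ (λ a b → b2n a + b2n b) Sv Sw ⟨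
  b2n (S v) + b2n (S w)                      ≡⟨ cong (λ x → b2n (S v) + b2n (S x)) (punchIn-punchOut v≢w) ⟨
  b2n (S v) + b2n (S (punchIn v w′))         ≤⟨ +-monoʳ-≤ (b2n (S v)) (≤-sum (b2n ∘ S ∘ punchIn v) w′) ⟩
  b2n (S v) + sum (b2n ∘ S ∘ punchIn v)      ≡⟨ sum-remove {i = v} (b2n ∘ S) ⟨
  size S                                     ∎
  where
  open ≤-Reasoning
  w′ : Fin n
  w′ = punchOut v≢w

size-mono : {S S′ : VertexSet n} → S ⊆ S′ → size S ≤ size S′
size-mono {S = S} {S′} S⊆S′ = sum-mono-≤ λ w → b2n-mono (S w) (S′ w) (S⊆S′ w)
  where
  b2n-mono : ∀ s s′ → (s ≡ true → s′ ≡ true) → b2n s ≤ b2n s′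
  b2n-mono false _ _    = z≤n
  b2n-mono true  _ s⇒s′ rewrite s⇒s′ refl = ≤-refl

size-∖ : {R U : VertexSet n} → R ⊆ U → size U ≡ size (U ∖ R) + size R
size-∖ {R = R} {U} R⊆U = trans (sum-cong-≗ λ w → b2n-split (U w) (R w) (R⊆U w))
                               (∑-distrib-+ (b2n ∘ (U ∖ R)) (b2n ∘ R))
  where
  b2n-split : ∀ u r → (r ≡ true → u ≡ true) → b2n u ≡ b2n (u ∧ not r) + b2n r
  b2n-split true  true  _   = refl
  b2n-split true  false _   = refl
  b2n-split false false _   = refl
  b2n-split false true  r⇒u with () ← r⇒u refl

size-⊂ : {S S′ : VertexSet n} (v : Fin n) → S ⊆ S′ → S′ v ≡ true → S v ≡ false → size S < size S′
size-⊂ {S = S} {S′} v S⊆S′ S′v Sv = begin-strict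
  size S                       <⟨ n<1+n (size S) ⟩
  1 + size S                   ≤⟨ +-monoˡ-≤ (size S) (size-pos {S = S′ ∖ S} (∈-∖ S′ S S′v Sv)) ⟩
  size (S′ ∖ S) + size S       ≡⟨ size-∖ S⊆S′ ⟨
  size S′                      ∎
  where open ≤-Reasoning

size-cong : {S S′ : VertexSet n} → (∀ w → S w ≡ S′ w) → size S ≡ size S′
size-cong S≗S′ = sum-cong-≗ (cong b2n ∘ S≗S′)

size-single : (S : VertexSet n) (v : Fin n) → size (λ w → S w ∧ (w == v)) ≡ b2n (S v)
size-single S v = trans (sum-single v off) on
  where
  off : ∀ w → w ≢ v → b2n (S w ∧ (w == v)) ≡ 0
  off w w≢v rewrite ==-≢ w≢v = cong b2n (∧-zeroʳ (S w))
  on : b2n (S v ∧ (v == v)) ≡ b2n (S v)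
  on rewrite ==-refl v = cong b2n (∧-identityʳ (S v))

degIn : Graph n → VertexSet n → Fin n → ℕ
degIn G S u = size (G u ∩ S)

deg-size : (G : Graph n) (u : Fin n) → deg G u ≡ size (G u)
deg-size G u = sum-allFin (λ w → b2n (G u w))

degIn-full : (G : Graph n) (u : Fin n) → degIn G (λ _ → true) u ≡ deg G u
degIn-full G u = sym (trans (deg-size G u) (size-cong λ w → sym (∧-identityʳ (G u w))))

degIn-mono : (G : Graph n) {S S′ : VertexSet n} (u : Fin n) →
             (∀ w → G u w ≡ true → S w ≡ true → S′ w ≡ true) → degIn G S u ≤ degIn G S′ u
degIn-mono G u S⇒S′ = size-mono ∩⊆∩
  where
  ∩⊆∩ : ∀ w → G u w ∧ _ ≡ true → G u w ∧ _ ≡ true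
  ∩⊆∩ w e with G u w in g
  ... | true = S⇒S′ w g e

degIn-∖ : (G : Graph n) {R U : VertexSet n} (u : Fin n) → R ⊆ U →
          degIn G U u ≡ degIn G (U ∖ R) u + degIn G R u
degIn-∖ G {R} {U} u R⊆U = trans (size-∖ ∩⊆∩) (cong (_+ degIn G R u) (size-cong ∩∖∩))
  where
  ∩⊆∩ : (G u ∩ R) ⊆ (G u ∩ U)
  ∩⊆∩ w e with G u w
  ... | true = R⊆U w e
  ∩∖∩ : ∀ w → ((G u ∩ U) ∖ (G u ∩ R)) w ≡ (G u ∩ (U ∖ R)) w
  ∩∖∩ w with G u w
  ... | true  = refl
  ... | false = refl

degIn-insert : (G : Graph n) {S : VertexSet n} (u v : Fin n) → S v ≡ false →
               degIn G (insert v S) u ≡ degIn G S u + b2n (G u v)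
degIn-insert G {S} u v Sv = begin
  degIn G (insert v S) u                              ≡⟨ degIn-∖ G u (λ w Sw → cong (_∨ (w == v)) Sw) ⟩
  degIn G (insert v S ∖ S) u + degIn G S u            ≡⟨ cong (_+ degIn G S u) (size-cong new) ⟩
  size (λ w → G u w ∧ (w == v)) + degIn G S u         ≡⟨ cong (_+ degIn G S u) (size-single (G u) v) ⟩
  b2n (G u v) + degIn G S u                           ≡⟨ +-comm (b2n (G u v)) _ ⟩
  degIn G S u + b2n (G u v)                           ∎
  where
  open ≡-Reasoning
  new : ∀ w → G u w ∧ ((S w ∨ (w == v)) ∧ not (S w)) ≡ G u w ∧ (w == v)
  new w with S w in Sw
  ... | false = cong (G u w ∧_) (∧-identityʳ (w == v))
  ... | true  = cong (G u w ∧_) (sym (==-≢ {x = w} {y = v} λ { refl → contradiction (trans (sym Sw) Sv) λ () }))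

degIn-∪ : (G : Graph n) (S S′ : VertexSet n) (u : Fin n) →
          degIn G (λ w → S w ∨ S′ w) u ≤ degIn G S u + degIn G S′ u
degIn-∪ G S S′ u = ≤-trans (sum-mono-≤ λ w → b2n-∨ (G u w) (S w) (S′ w))
                           (≤-reflexive (∑-distrib-+ (b2n ∘ (G u ∩ S)) (b2n ∘ (G u ∩ S′))))
  where
  b2n-∨ : ∀ g s s′ → b2n (g ∧ (s ∨ s′)) ≤ b2n (g ∧ s) + b2n (g ∧ s′)
  b2n-∨ false _     _  = z≤n
  b2n-∨ true  true  _  = s≤s z≤n
  b2n-∨ true  false _  = ≤-refl

degIn-witness : (G : Graph n) (S : VertexSet n) (u : Fin n) → 1 ≤ degIn G S u →
                ∃ λ w → G u w ≡ true × S w ≡ true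
degIn-witness G S u 1≤d = let w , e = size-witness (G u ∩ S) 1≤d
                          in w , ∧-conicalˡ _ _ e , ∧-conicalʳ _ _ e

-- Firing

Undirected Loopless : Graph n → Set
Undirected G = ∀ u v → G u v ≡ G v u
Loopless   G = ∀ u → G u u ≡ false

degIn-∅ : (G : Graph n) (u : Fin n) → degIn G (λ _ → false) u ≡ 0
degIn-∅ {n} G u = trans (size-cong (∧-zeroʳ ∘ G u)) (sum-replicate-zero n)

degIn-pos : (G : Graph n) {S : VertexSet n} {u w : Fin n} → G u w ≡ true → S w ≡ true → 1 ≤ degIn G S u
degIn-pos G {S} {u} {w} Guw Sw = size-pos {S = G u ∩ S} (cong₂ _∧_ Guw Sw)

module _ (G : Graph n) where

  fire-self : (i : Fin n) (c : Config n) → fire G i c i ≡ c i ∸ deg G i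
  fire-self i c rewrite ==-refl i = refl

  fire-other : {i j : Fin n} (c : Config n) → i ≢ j → fire G i c j ≡ c j + b2n (G i j)
  fire-other {i} {j} c i≢j rewrite ==-≢ i≢j with G i j
  ... | true  = +-comm 1 (c j)
  ... | false = sym (+-identityʳ (c j))

  fire-cong : (i : Fin n) {c c′ : Config n} (j : Fin n) → c j ≡ c′ j → fire G i c j ≡ fire G i c′ j
  fire-cong i j = cong λ x → if i == j then x ∸ deg G i else (if G i j then suc x else x)

  runs-cong : ∀ {c c′ d d′ is} → c ≗ c′ → d ≗ d′ → Runs G c is d → Runs G c′ is d′
  runs-cong c≗c′ d≗d′ (done c≗d) = done λ j → trans (sym (c≗c′ j)) (trans (c≗d j) (d≗d′ j))
  runs-cong {c} {c′} c≗c′ d≗d′ (step {i = i} legal r) =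
    step (subst (deg G i ≤_) (c≗c′ i) legal) (runs-cong (λ j → fire-cong i {c} {c′} j (c≗c′ j)) d≗d′ r)

  selfReachable-cong : ∀ {c c′} → c ≗ c′ → SelfReachable G c → SelfReachable G c′
  selfReachable-cong c≗c′ (i , is , r) = i , is , runs-cong c≗c′ c≗c′ r

  -- Legality is what lets the truncated subtraction commute with the extra chips e.
  fire-+ : ∀ {i} (c e : Config n) → deg G i ≤ c i → fire G i (λ j → c j + e j) ≗ (λ j → fire G i c j + e j)
  fire-+ {i} c e legal j with i ≟ j
  ... | yes refl = +-∸-comm (e i) legal
  ... | no _ with G i j
  ...   | true  = refl
  ...   | false = refl

  runs-+ : ∀ {c d is} (e : Config n) → Runs G c is d → Runs G (λ j → c j + e j) is (λ j → d j + e j)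
  runs-+ e (done c≗d) = done λ j → cong (_+ e j) (c≗d j)
  runs-+ {c} e (step legal r) =
    step (≤-trans legal (m≤m+n _ _)) (runs-cong (sym ∘ fire-+ c e legal) (λ _ → refl) (runs-+ e r))

  selfReachable-mono : ∀ {c c′} → SelfReachable G c → (∀ j → c j ≤ c′ j) → SelfReachable G c′
  selfReachable-mono {c} {c′} (i , is , r) c≤c′ =
    i , is , runs-cong c+[c′∸c]≗c′ c+[c′∸c]≗c′ (runs-+ (λ j → c′ j ∸ c j) r)
    where
    c+[c′∸c]≗c′ : (λ j → c j + (c′ j ∸ c j)) ≗ c′
    c+[c′∸c]≗c′ j = m+[n∸m]≡n (c≤c′ j)

fired : List (Fin n) → VertexSet n
fired is w = does (any? (w ≟_) is)

∈⇒fired : {w : Fin n} {is : List (Fin n)} → w ∈ is → fired is w ≡ true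
∈⇒fired {w = w} {is} = dec-true (any? (w ≟_) is)

module _ {G : Graph n} (undirected : Undirected G) where

  unfired-gains : ∀ {c d is v} → Runs G c is d → v ∉ is → c v + degIn G (fired is) v ≤ d v
  unfired-gains {c} {v = v} (done c≗d) _ =
    ≤-reflexive (trans (cong (c v +_) (degIn-∅ G v)) (trans (+-identityʳ (c v)) (c≗d v)))
  unfired-gains {c} {d} {i ∷ is} {v} (step _ r) v∉i∷is = begin
    c v + degIn G (fired (i ∷ is)) v                    ≤⟨ +-monoʳ-≤ (c v) (degIn-∪ G (_== i) (fired is) v) ⟩
    c v + (size (λ w → G v w ∧ (w == i)) + degIn G (fired is) v)
      ≡⟨ cong (λ x → c v + (x + degIn G (fired is) v)) (size-single (G v) i) ⟩
    c v + (b2n (G v i) + degIn G (fired is) v)          ≡⟨ +-assoc (c v) _ _ ⟨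
    c v + b2n (G v i) + degIn G (fired is) v
      ≡⟨ cong (λ x → c v + b2n x + degIn G (fired is) v) (undirected v i) ⟩
    c v + b2n (G i v) + degIn G (fired is) v            ≡⟨ cong (_+ degIn G (fired is) v) (fire-other G c i≢v) ⟨
    fire G i c v + degIn G (fired is) v                 ≤⟨ unfired-gains r (v∉i∷is ∘ there) ⟩
    d v                                                 ∎
    where
    open ≤-Reasoning
    i≢v : i ≢ v
    i≢v i≡v = v∉i∷is (here (sym i≡v))

  -- In a closed run a neighbour of a fired vertex must fire too, or it would end up richer.
  fired-closed : ∀ {c is u w} → Runs G c is c → u ∈ is → G u w ≡ true → w ∈ is
  fired-closed {c} {is} {u} {w} r u∈is Guw with any? (w ≟_) is
  ... | yes w∈is = w∈is
  ... | no  w∉is = contradiction (unfired-gains r w∉is) (<⇒≱ (m<m+n (c w) gain))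
    where
    gain : 1 ≤ degIn G (fired is) w
    gain = degIn-pos G (trans (undirected w u) Guw) (∈⇒fired u∈is)

  selfLoop-fires-all : (∀ u v → Connected G u v) → ∀ {c i is} → Runs G c (i ∷ is) c → ∀ v → v ∈ i ∷ is
  selfLoop-fires-all connected {i = i} r v = walk-fired (connected i v) (here refl)
    where
    walk-fired : ∀ {u v} → Connected G u v → u ∈ _ → v ∈ _
    walk-fired here              u∈is = u∈is
    walk-fired (step Guw u⇝v) u∈is = walk-fired u⇝v (fired-closed r u∈is Guw)

  module _ (loopless : Loopless G) where

    -- u is the vertex of V whose last firing comes first; all of V ∖ {u} fires after it.
    runs⇒rich-vertex : (V : VertexSet n) {v₀ : Fin n} → V v₀ ≡ true → ∀ {c d is} → Runs G c is d →
                (∀ w → V w ≡ true → w ∈ is) → ∃ λ u → V u ≡ true × degIn G V u ≤ d u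
    runs⇒rich-vertex V Vv₀ (done _) V⊆is with () ← V⊆is _ Vv₀
    runs⇒rich-vertex V Vv₀ (step {i = i} {is = is} _ r) V⊆is
      with Fin.any? (λ w → (V w ≟ᵇ true) ×-dec ¬? (any? (w ≟_) is))
    ... | no none = runs⇒rich-vertex V Vv₀ r λ w Vw →
                      decidable-stable (any? (w ≟_) is) λ w∉is → none (w , Vw , w∉is)
    ... | yes (u , Vu , u∉is) =
      u , Vu , ≤-trans (degIn-mono G u V⇒fired) (≤-trans (m≤n+m _ _) (unfired-gains r u∉is))
      where
      u≡i : u ≡ i
      u≡i with V⊆is u Vu
      ... | here u≡i  = u≡i
      ... | there u∈is = contradiction u∈is u∉is
      V⇒fired : ∀ w → G u w ≡ true → V w ≡ true → fired is w ≡ true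
      V⇒fired w Guw Vw with V⊆is w Vw
      ... | there w∈is = ∈⇒fired w∈is
      ... | here refl with () ← trans (sym Guw) (trans (cong (G u) (sym u≡i)) (loopless u))

    selfReachable⇒rich-vertex : (∀ u v → Connected G u v) → ∀ {c} → SelfReachable G c →
                                (V : VertexSet n) {v₀ : Fin n} → V v₀ ≡ true →
                                ∃ λ u → V u ≡ true × degIn G V u ≤ c u
    selfReachable⇒rich-vertex connected (i , is , r) V Vv₀ =
      runs⇒rich-vertex V Vv₀ r λ w _ → selfLoop-fires-all connected r w

-- Stuck sets

Stuck : Graph n → Config n → VertexSet n → Set
Stuck G C U = (∃ λ u → U u ≡ true) × (∀ u → U u ≡ true → C u < degIn G U u)

-- Fire, one at a time and each at most once, any vertex that can afford it: either every vertex
-- fires, which closes the run at C, or the vertices left over form a stuck set.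
module Greedy {G : Graph n} (undirected : Undirected G) (loopless : Loopless G) (C : Config n) where

  spent : VertexSet n → Fin n → ℕ
  spent S w = if S w then deg G w else 0

  after : VertexSet n → Config n
  after S w = C w + degIn G S w ∸ spent S w

  Affordable : VertexSet n → Set
  Affordable S = ∀ w → spent S w ≤ C w + degIn G S w

  spent-if : ∀ S w {b} → S w ≡ b → spent S w ≡ (if b then deg G w else 0)
  spent-if S w Sw≡b = cong (λ b → if b then deg G w else 0) Sw≡b

  fire-after : ∀ {S v} → S v ≡ false → Affordable S → fire G v (after S) ≗ after (insert v S)
  fire-after {S} {v} Sv affordable = split-at v (begin
    fire G v (after S) v
      ≡⟨ fire-self G v (after S) ⟩
    C v + degIn G S v ∸ spent S v ∸ deg G v
      ≡⟨ cong (λ s → C v + degIn G S v ∸ s ∸ deg G v) (spent-if S v Sv) ⟩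
    C v + degIn G S v ∸ deg G v
      ≡⟨ cong (λ x → C v + x ∸ deg G v) (+-identityʳ _) ⟨
    C v + (degIn G S v + 0) ∸ deg G v
      ≡⟨ cong (λ b → C v + (degIn G S v + b2n b) ∸ deg G v) (loopless v) ⟨
    C v + (degIn G S v + b2n (G v v)) ∸ deg G v
      ≡⟨ cong (λ x → C v + x ∸ deg G v) (degIn-insert G v v Sv) ⟨
    C v + degIn G (insert v S) v ∸ deg G v
      ≡⟨ cong (C v + degIn G (insert v S) v ∸_) (spent-if (insert v S) v (insert-self S v)) ⟨
    after (insert v S) v
      ∎)
    λ w w≢v → begin
    fire G v (after S) w
      ≡⟨ fire-other G (after S) (w≢v ∘ sym) ⟩
    C w + degIn G S w ∸ spent S w + b2n (G v w)
      ≡⟨ +-∸-comm (b2n (G v w)) (affordable w) ⟨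
    C w + degIn G S w + b2n (G v w) ∸ spent S w
      ≡⟨ cong (_∸ spent S w) (+-assoc (C w) _ _) ⟩
    C w + (degIn G S w + b2n (G v w)) ∸ spent S w
      ≡⟨ cong (λ b → C w + (degIn G S w + b2n b) ∸ spent S w) (undirected v w) ⟩
    C w + (degIn G S w + b2n (G w v)) ∸ spent S w
      ≡⟨ cong (λ x → C w + x ∸ spent S w) (degIn-insert G w v Sv) ⟨
    C w + degIn G (insert v S) w ∸ spent S w
      ≡⟨ cong (C w + degIn G (insert v S) w ∸_) (spent-if (insert v S) w (insert-other S (w≢v ∘ sym))) ⟨
    after (insert v S) w
      ∎
    where open ≡-Reasoning

  affordable-insert : ∀ {S v} → S v ≡ false → Affordable S → deg G v ≤ C v + degIn G S v →
                      Affordable (insert v S)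
  affordable-insert {S} {v} Sv affordable legal w =
    ≤-trans (spent-insert w) (+-monoʳ-≤ (C w) (degIn-mono G w λ x _ Sx → cong (_∨ (x == v)) Sx))
    where
    spent-insert : ∀ w → spent (insert v S) w ≤ C w + degIn G S w
    spent-insert w with v ≟ w
    ... | yes refl = ≤-trans (≤-reflexive (spent-if (insert v S) v (insert-self S v))) legal
    ... | no v≢w   = ≤-trans (≤-reflexive (spent-if (insert v S) w (insert-other S v≢w))) (affordable w)

  after-∅ : after (λ _ → false) ≗ C
  after-∅ w = trans (cong (C w +_) (degIn-∅ G w)) (+-identityʳ (C w))

  after-full : ∀ {S} → (∀ w → S w ≡ true) → after S ≗ C
  after-full {S} all w = begin
    C w + degIn G S w ∸ spent S w  ≡⟨ cong₂ (λ d s → C w + d ∸ s) degIn-S (spent-if S w (all w)) ⟩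
    C w + deg G w ∸ deg G w        ≡⟨ m+n∸n≡m (C w) (deg G w) ⟩
    C w                            ∎
    where
    open ≡-Reasoning
    degIn-S : degIn G S w ≡ deg G w
    degIn-S = trans (size-cong λ x → cong (G w x ∧_) (all x)) (degIn-full G w)

  leftover-starved : ∀ {S} → (∀ u → S u ≡ false → C u + degIn G S u < deg G u) →
                     ∀ u → ∁ S u ≡ true → C u < degIn G (∁ S) u
  leftover-starved {S} unaffordable u ¬Su = +-cancelʳ-< (degIn G S u) (C u) (degIn G (∁ S) u) (begin-strict
    C u + degIn G S u                    <⟨ unaffordable u (not-true ¬Su) ⟩
    deg G u                              ≡⟨ degIn-full G u ⟨
    degIn G (λ _ → true) u               ≡⟨ degIn-∖ G u (λ _ _ → refl) ⟩
    degIn G (∁ S) u + degIn G S u        ∎)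
    where
    open ≤-Reasoning
    not-true : ∀ {b} → not b ≡ true → b ≡ false
    not-true {false} _ = refl

  greedy : ∀ fuel S → Affordable S → size (∁ S) ≤ fuel →
           (∃ λ is → Runs G (after S) is C × (∀ w → S w ≡ false → w ∈ is)) ⊎ ∃ (Stuck G C)
  greedy fuel S affordable bound with Fin.any? (λ v → (S v ≟ᵇ false) ×-dec (deg G v ≤? C v + degIn G S v))
  greedy zero S _ bound | yes (v , Sv , _) =
    contradiction bound (<⇒≱ (size-pos {S = ∁ S} (cong not Sv)))
  greedy (suc fuel) S affordable bound | yes (v , Sv , legal)
    with greedy fuel (insert v S) (affordable-insert Sv affordable legal) bound′
    where
    bound′ : size (∁ (insert v S)) ≤ fuel
    bound′ = s≤s⁻¹ (≤-trans (size-⊂ v (∖-insert _ S v) (cong not Sv) (∉-∖-insert _ S v)) bound)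
  ... | inj₂ stuck = inj₂ stuck
  ... | inj₁ (is , r , covers) =
    inj₁ (v ∷ is , step legal′ (runs-cong G (sym ∘ fire-after Sv affordable) (λ _ → refl) r) , covers′)
    where
    legal′ : deg G v ≤ after S v
    legal′ = subst (deg G v ≤_) (cong (C v + degIn G S v ∸_) (sym (spent-if S v Sv))) legal
    covers′ : ∀ w → S w ≡ false → w ∈ v ∷ is
    covers′ w Sw with v ≟ w
    ... | yes v≡w = here (sym v≡w)
    ... | no  v≢w = there (covers w (trans (insert-other S v≢w) Sw))
  greedy fuel S _ _ | no stuck-everywhere with Fin.any? (λ v → S v ≟ᵇ false)
  ... | yes (v , Sv) =
    inj₂ (∁ S , (v , cong not Sv) , leftover-starved λ u Su → ≰⇒> λ legal → stuck-everywhere (u , Su , legal))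
  ... | no none-left = inj₁ ([] , done (after-full all-fired) , λ w Sw → contradiction (w , Sw) none-left)
    where
    all-fired : ∀ w → S w ≡ true
    all-fired w with S w in Sw
    ... | true  = refl
    ... | false = contradiction (w , Sw) none-left

selfReachable-or-stuck : {G : Graph (suc n)} → Undirected G → Loopless G → (C : Config (suc n)) →
                         SelfReachable G C ⊎ ∃ (Stuck G C)
selfReachable-or-stuck {n} {G} undirected loopless C =
  Sum.map₁ closed-run (greedy (size {suc n} (λ _ → true)) (λ _ → false) (λ _ → z≤n) ≤-refl)
  where
  open Greedy undirected loopless C
  closed-run : (∃ λ is → Runs G (after (λ _ → false)) is C × (∀ w → false ≡ false → w ∈ is)) →
               SelfReachable G C
  closed-run ([] , _ , covers) with () ← covers zero refl
  closed-run (i ∷ is , r , _) = i , is , runs-cong G after-∅ (λ _ → refl) r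

-- Walks and trees

Connected-map : {G : Graph n} {G′ : Graph n′} (f : Fin n → Fin n′) →
                (∀ {x y} → G x y ≡ true → f x ≡ f y ⊎ G′ (f x) (f y) ≡ true) →
                ∀ {u v} → Connected G u v → Connected G′ (f u) (f v)
Connected-map f edge here = here
Connected-map {G′ = G′} f edge {v = v} (step Guw w⇝v) with edge Guw
... | inj₁ fu≡fw = subst (λ x → Connected G′ x (f v)) (sym fu≡fw) (Connected-map f edge w⇝v)
... | inj₂ G′fufw = step G′fufw (Connected-map f edge w⇝v)

Connected-++ : {G : Graph n} {u v w : Fin n} → Connected G u v → Connected G v w → Connected G u w
Connected-++ here           v⇝w = v⇝w
Connected-++ (step Gux x⇝v) v⇝w = step Gux (Connected-++ x⇝v v⇝w)

Connected-reverse : {G : Graph n} → Undirected G → {u v : Fin n} → Connected G u v → Connected G v u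
Connected-reverse undirected here                 = here
Connected-reverse undirected (step {w = w} Guw w⇝v) =
  Connected-++ (Connected-reverse undirected w⇝v) (step (trans (undirected w _) Guw) here)

==-∧-false : {a b c d : Fin n} → ¬ (a ≡ b × c ≡ d) → (a == b ∧ c == d) ≡ false
==-∧-false {a = a} {b} {c} {d} ¬a≡b×c≡d with a ≟ b | c ≟ d
... | no _      | _         = refl
... | yes _     | no _      = refl
... | yes a≡b   | yes c≡d   = contradiction (a≡b , c≡d) ¬a≡b×c≡d

deleteEdge-keeps : {G : Graph n} {u v x y : Fin n} → G x y ≡ true →
                   ¬ (x ≡ u × y ≡ v) → ¬ (x ≡ v × y ≡ u) → deleteEdge G u v x y ≡ true
deleteEdge-keeps Gxy ¬uv ¬vu rewrite Gxy | ==-∧-false ¬uv | ==-∧-false ¬vu = refl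

induced : Graph n → VertexSet n → Graph n
induced G R x y = G x y ∧ (R x ∧ R y)

module _ (G : Graph n) (R : VertexSet n) {x y : Fin n} where

  induced-edge : induced G R x y ≡ true → G x y ≡ true × R x ≡ true × R y ≡ true
  induced-edge e with G x y | R x | R y
  ... | true | true | true = refl , refl , refl

  induced-edge⁻ : G x y ≡ true → R x ≡ true → R y ≡ true → induced G R x y ≡ true
  induced-edge⁻ Gxy Rx Ry rewrite Gxy | Rx | Ry = refl

induced-mono : (G : Graph n) {R R′ : VertexSet n} → R ⊆ R′ →
               ∀ {x y} → Connected (induced G R) x y → Connected (induced G R′) x y
induced-mono G {R} {R′} R⊆R′ = Connected-map id λ {x} {y} e →
  let Gxy , Rx , Ry = induced-edge G R e in inj₂ (induced-edge⁻ G R′ Gxy (R⊆R′ x Rx) (R⊆R′ y Ry))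

module _ {G : Graph (suc n)} (tree : IsTree G) where

  open IsTree tree

  -- Two neighbours of p joined avoiding p would close a cycle through p.
  no-two-branches : ∀ {R p j} → R p ≡ false → (∀ r → R r ≡ true → Connected (induced G R) r j) →
                    2 ≤ degIn G R p → ⊥
  no-two-branches {R} {p} Rp R⇝j 2≤deg with size-witness₂ (G p ∩ R) 2≤deg
  ... | a , b , a≢b , pa , pb = edgeBridges p a (∧-conicalˡ (G p a) (R a) pa) p⇝a
    where
    ≢p : ∀ {x} → R x ≡ true → x ≢ p
    ≢p Rx refl with () ← trans (sym Rx) Rp
    avoid-pa : ∀ {x y} → induced G R x y ≡ true → deleteEdge G p a x y ≡ true
    avoid-pa {x} {y} e = let Gxy , Rx , Ry = induced-edge G R e
                         in deleteEdge-keeps {G = G} Gxy (≢p Rx ∘ proj₁) (≢p Ry ∘ proj₂)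
    induced-undirected : Undirected (induced G R)
    induced-undirected x y = cong₂ _∧_ (symmetric x y) (∧-comm (R x) (R y))
    Ra : R a ≡ true
    Ra = ∧-conicalʳ (G p a) (R a) pa
    Rb : R b ≡ true
    Rb = ∧-conicalʳ (G p b) (R b) pb
    p⇝a : Connected (deleteEdge G p a) p a
    p⇝a = step (deleteEdge-keeps {G = G} (∧-conicalˡ (G p b) (R b) pb)
                                 (a≢b ∘ sym ∘ proj₂) (≢p Ra ∘ sym ∘ proj₁))
               (Connected-map id (inj₂ ∘ avoid-pa)
                 (Connected-++ (R⇝j b Rb) (Connected-reverse induced-undirected (R⇝j a Ra))))

  module Peel {j p : Fin (suc n)} {A C : Config (suc n)} (srA : SelfReachable G A)
              (A≤C : ∀ u → u ≢ j → u ≢ p → A u ≤ C u) (Ap<Cp : A p < C p)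
              {U : VertexSet (suc n)} (starved : ∀ u → U u ≡ true → C u < degIn G U u) (Up : U p ≡ true) where

    spare : ∀ {R u} k → R ⊆ U → U u ≡ true → degIn G (U ∖ R) u ≤ A u → A u + k ≤ C u → suc k ≤ degIn G R u
    spare {R} {u} k R⊆U Uu rich A+k≤C = +-cancelˡ-≤ (degIn G (U ∖ R) u) (suc k) (degIn G R u) (begin
      degIn G (U ∖ R) u + suc k        ≤⟨ +-monoˡ-≤ (suc k) rich ⟩
      A u + suc k                      ≡⟨ +-suc (A u) k ⟩
      suc (A u + k)                    ≤⟨ s≤s A+k≤C ⟩
      suc (C u)                        ≤⟨ starved u Uu ⟩
      degIn G U u                      ≡⟨ degIn-∖ G u R⊆U ⟩
      degIn G (U ∖ R) u + degIn G R u  ∎)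
      where open ≤-Reasoning

    peel : ∀ fuel R → R ⊆ U → R p ≡ false → (∀ r → R r ≡ true → Connected (induced G R) r j) →
           size (U ∖ R) ≤ fuel → ⊥
    peel fuel R R⊆U Rp R⇝j bound
      with selfReachable⇒rich-vertex symmetric loopless connected srA (U ∖ R) (∈-∖ U R Up Rp)
    ... | u , u∈U∖R , rich with u ≟ p | ∈-∖⁻ U R u∈U∖R
    ...   | yes refl | _ = no-two-branches Rp R⇝j (spare 1 R⊆U Up rich (subst (_≤ C p) (+-comm 1 (A p)) Ap<Cp))
    ...   | no u≢p | Uu , _ with fuel
    ...     | zero = contradiction bound (<⇒≱ (size-pos {S = U ∖ R} u∈U∖R))
    ...     | suc fuel′ = peel fuel′ (insert u R) R′⊆U (trans (insert-other R u≢p) Rp) R′⇝j bound′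
      where
      R⊆R′ : R ⊆ insert u R
      R⊆R′ _ = insert-⊇ R u
      u⇝j : Connected (induced G (insert u R)) u j
      u⇝j with u ≟ j
      ... | yes refl = here
      ... | no u≢j =
        let Au≤Cu = ≤-trans (≤-reflexive (+-identityʳ (A u))) (A≤C u u≢j u≢p)
            w , Guw , Rw = degIn-witness G R u (spare 0 R⊆U Uu rich Au≤Cu)
        in step (induced-edge⁻ G (insert u R) Guw (insert-self R u) (insert-⊇ R u Rw))
                (induced-mono G R⊆R′ (R⇝j w Rw))
      R′⊆U : insert u R ⊆ U
      R′⊆U w e with insert-true {S = R} {v = u} e
      ... | inj₁ Rw   = R⊆U w Rw
      ... | inj₂ refl = Uu
      R′⇝j : ∀ r → insert u R r ≡ true → Connected (induced G (insert u R)) r j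
      R′⇝j r e with insert-true {S = R} {v = u} e
      ... | inj₁ Rr   = induced-mono G R⊆R′ (R⇝j r Rr)
      ... | inj₂ refl = u⇝j
      bound′ : size (U ∖ insert u R) ≤ fuel′
      bound′ = s≤s⁻¹ (≤-trans (size-⊂ u (∖-insert U R u) u∈U∖R (∉-∖-insert U R u)) bound)

  -- A stuck set for C must contain p, because Y is self-reachable and C ≥ Y away from p.  Growing
  -- from j a set R ⊆ U ∖ {p} joined to j inside R, the self-reachability of A always supplies a
  -- vertex of U ∖ R adjacent to R, until p itself has two neighbours in R: a cycle.
  selfReachable-patch : ∀ {j p Y A C} → SelfReachable G Y → SelfReachable G A →
                        (∀ u → u ≢ p → Y u ≤ C u) → (∀ u → u ≢ j → u ≢ p → A u ≤ C u) → A p < C p →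
                        SelfReachable G C
  selfReachable-patch {j} {p} {Y} {A} {C} srY srA Y≤C A≤C Ap<Cp
    with selfReachable-or-stuck symmetric loopless C
  ... | inj₁ srC = srC
  ... | inj₂ (U , (u₀ , Uu₀) , starved)
    with selfReachable⇒rich-vertex symmetric loopless connected srY U Uu₀
  ...   | u , Uu , rich with u ≟ p
  ...     | no u≢p   = contradiction (≤-trans rich (Y≤C u u≢p)) (<⇒≱ (starved u Uu))
  ...     | yes refl = ⊥-elim (Peel.peel srA A≤C Ap<Cp starved Uu (size (U ∖ (λ _ → false))) (λ _ → false)
                                 (λ _ ()) refl (λ _ ()) ≤-refl)

-- Contracting the leaf edge

pinch-inject₁ : ∀ {k} (i : Fin (suc k)) → pinch (fromℕ k) (inject₁ i) ≡ i
pinch-inject₁ {zero}  zero    = refl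
pinch-inject₁ {suc k} zero    = refl
pinch-inject₁ {suc k} (suc i) = cong suc (pinch-inject₁ i)

pinch-fromℕ : ∀ k → pinch (fromℕ k) (fromℕ (suc k)) ≡ fromℕ k
pinch-fromℕ zero    = refl
pinch-fromℕ (suc k) = cong suc (pinch-fromℕ k)

==-inject₁ : (x y : Fin n) → (inject₁ x == inject₁ y) ≡ (x == y)
==-inject₁ x y with x ≟ y
... | yes refl = ==-refl (inject₁ x)
... | no x≢y   = ==-≢ (x≢y ∘ inject₁-injective)

minusE-self : (c : Config n) (i : Fin n) → minusE c i i ≡ c i ∸ 1
minusE-self c i rewrite ==-refl i = refl

minusE-other : (c : Config n) {i j : Fin n} → i ≢ j → minusE c i j ≡ c j
minusE-other c i≢j rewrite ==-≢ i≢j = refl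

minusE-cong : {c c′ : Config n} (i j : Fin n) → c j ≡ c′ j → minusE c i j ≡ minusE c′ i j
minusE-cong i j = cong λ z → if i == j then z ∸ 1 else z

minusE-mono : {x y : Config n} {q : Fin n} → (∀ i → x i ≤ y i) → ∀ i → minusE x q i ≤ minusE y q i
minusE-mono {q = q} x≤y i with q == i
... | true  = ∸-monoˡ-≤ 1 (x≤y i)
... | false = x≤y i

decSR-cong : {G : Graph n} {c c′ : Config n} {i : Fin n} → c ≗ c′ → DecSR G c i → DecSR G c′ i
decSR-cong {G = G} {c} {c′} {i} c≗c′ (1≤ci , sr) =
  subst (1 ≤_) (c≗c′ i) 1≤ci , selfReachable-cong G (λ j → minusE-cong {c = c} {c′} i j (c≗c′ j)) sr

plusE-self : (c : Config n) (i : Fin n) (L : ℕ) → plusE c i L i ≡ c i + L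
plusE-self c i L rewrite ==-refl i = refl

plusE-other : (c : Config n) {i j : Fin n} (L : ℕ) → i ≢ j → plusE c i L j ≡ c j
plusE-other c L i≢j rewrite ==-≢ i≢j = refl

snoc-inject₁ : (x : Config n) (y : ℕ) (i : Fin n) → snoc x y (inject₁ i) ≡ x i
snoc-inject₁ {suc n} x y zero    = refl
snoc-inject₁ {suc n} x y (suc i) = snoc-inject₁ (x ∘ suc) y i

snoc-fromℕ : (x : Config n) (y : ℕ) → snoc x y (fromℕ n) ≡ y
snoc-fromℕ {zero}  x y = refl
snoc-fromℕ {suc n} x y = snoc-fromℕ (x ∘ suc) y

total-snoc : (x : Config n) (y : ℕ) → total (snoc x y) ≡ total x + y
total-snoc x y = begin
  total (snoc x y)                          ≡⟨ sum-allFin (snoc x y) ⟩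
  sum (snoc x y)                            ≡⟨ sum-init-last (snoc x y) ⟩
  sum (snoc x y ∘ inject₁) + snoc x y (fromℕ _) ≡⟨ cong₂ _+_ (sum-cong-≗ (snoc-inject₁ x y)) (snoc-fromℕ x y) ⟩
  sum x + y                                 ≡⟨ cong (_+ y) (sum-allFin x) ⟨
  total x + y                               ∎
  where open ≡-Reasoning

total-plusE : (x : Config n) (i : Fin n) (L : ℕ) → total (plusE x i L) ≡ total x + L
total-plusE {suc n} x i L = begin
  total (plusE x i L)                             ≡⟨ sum-allFin (plusE x i L) ⟩
  sum (plusE x i L)                               ≡⟨ sum-remove {i = i} (plusE x i L) ⟩
  plusE x i L i + sum (removeAt (plusE x i L) i)
    ≡⟨ cong₂ _+_ (plusE-self x i L) (sum-cong-≗ λ j → plusE-other x L (punchInᵢ≢i i j ∘ sym)) ⟩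
  x i + L + sum (removeAt x i)                    ≡⟨ +-assoc (x i) L _ ⟩
  x i + (L + sum (removeAt x i))                  ≡⟨ cong (x i +_) (+-comm L _) ⟩
  x i + (sum (removeAt x i) + L)                  ≡⟨ +-assoc (x i) _ L ⟨
  x i + sum (removeAt x i) + L                    ≡⟨ cong (_+ L) (sum-remove {i = i} x) ⟨
  sum x + L                                       ≡⟨ cong (_+ L) (sum-allFin x) ⟨
  total x + L                                     ∎
  where open ≡-Reasoning

module LeafContraction {k : ℕ} {T : Graph (suc (suc k))} (tree : IsTree T)
       (leaf-adjacent : T (fromℕ (suc k)) (inject₁ (fromℕ k)) ≡ true)
       (leaf-deg : deg T (fromℕ (suc k)) ≡ 1) where

  open IsTree tree

  H : Graph (suc k)
  H = deleteLast T

  ι : Fin (suc k) → Fin (suc (suc k))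
  ι = inject₁

  p : Fin (suc k)
  p = fromℕ k

  P leaf : Fin (suc (suc k))
  P    = ι p
  leaf = fromℕ (suc k)

  leaf≢ι : ∀ {i} → leaf ≢ ι i
  leaf≢ι = fromℕ≢inject₁

  ι≢leaf : ∀ {i} → ι i ≢ leaf
  ι≢leaf = leaf≢ι ∘ sym

  ι≢ι : ∀ {i j} → i ≢ j → ι i ≢ ι j
  ι≢ι i≢j = i≢j ∘ inject₁-injective

  leaf-neighbour : ∀ {w} → T leaf w ≡ true → w ≡ P
  leaf-neighbour {w} Tw with w ≟ P
  ... | yes w≡P = w≡P
  ... | no  w≢P = contradiction (≤-trans (size-two (w≢P ∘ sym) leaf-adjacent Tw)
                                        (≤-reflexive (trans (sym (deg-size T leaf)) leaf-deg))) (λ { (s≤s ()) })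

  inner-not-leaf : ∀ {i} → i ≢ p → T (ι i) leaf ≡ false
  inner-not-leaf {i} i≢p with T (ι i) leaf in e
  ... | false = refl
  ... | true  = contradiction (inject₁-injective (leaf-neighbour (trans (symmetric leaf (ι i)) e))) i≢p

  P-leaf : T P leaf ≡ true
  P-leaf = trans (symmetric P leaf) leaf-adjacent

  deg-ι : ∀ i → deg T (ι i) ≡ deg H i + b2n (T (ι i) leaf)
  deg-ι i = trans (deg-size T (ι i)) (trans (sum-init-last (b2n ∘ T (ι i)))
                                            (cong (_+ b2n (T (ι i) leaf)) (sym (deg-size H i))))

  deg-inner : ∀ {i} → i ≢ p → deg T (ι i) ≡ deg H i
  deg-inner {i} i≢p = trans (deg-ι i) (trans (cong (λ b → deg H i + b2n b) (inner-not-leaf i≢p)) (+-identityʳ _))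

  deg-P : deg T P ≡ suc (deg H p)
  deg-P = trans (deg-ι p) (trans (cong (λ b → deg H p + b2n b) P-leaf) (+-comm (deg H p) 1))

  H-isTree : IsTree H
  H-isTree = record
    { symmetric   = λ u v → symmetric (ι u) (ι v)
    ; loopless    = λ u → loopless (ι u)
    ; connected   = λ u v → subst₂ (Connected H) (pinch-inject₁ u) (pinch-inject₁ v)
                                   (Connected-map (pinch p) contract-edge (connected (ι u) (ι v)))
    ; edgeBridges = λ u v Huv u⇝v → edgeBridges (ι u) (ι v) Huv (Connected-map ι lift-edge u⇝v)
    }
    where
    pinch-P≡pinch-leaf : pinch p P ≡ pinch p leaf
    pinch-P≡pinch-leaf = trans (pinch-inject₁ p) (sym (pinch-fromℕ k))
    contract-edge : ∀ {x y} → T x y ≡ true → pinch p x ≡ pinch p y ⊎ H (pinch p x) (pinch p y) ≡ true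
    contract-edge {x} {y} Txy with view x | view y
    ... | ‵fromℕ      | _ rewrite leaf-neighbour Txy = inj₁ (sym pinch-P≡pinch-leaf)
    ... | ‵inj₁ {i = i} _ | ‵fromℕ with i ≟ p
    ...   | yes refl = inj₁ pinch-P≡pinch-leaf
    ...   | no  i≢p  = contradiction (trans (sym Txy) (inner-not-leaf i≢p)) λ ()
    contract-edge Txy | ‵inj₁ {i = i} _ | ‵inj₁ {i = j} _ rewrite pinch-inject₁ i | pinch-inject₁ j = inj₂ Txy
    lift-edge : ∀ {u v x y} → deleteEdge H u v x y ≡ true →
                ι x ≡ ι y ⊎ deleteEdge T (ι u) (ι v) (ι x) (ι y) ≡ true
    lift-edge {u} {v} {x} {y} e
      rewrite ==-inject₁ x u | ==-inject₁ y v | ==-inject₁ x v | ==-inject₁ y u = inj₂ e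

  record Charged (c : Config (suc (suc k))) : Set where
    constructor charged
    field chips : 1 ≤ c P + c leaf

  -- A self-reachable configuration keeps a chip on the leaf edge for good; the contraction
  -- merges P with the leaf and drops that chip.
  contract : Config (suc (suc k)) → Config (suc k)
  contract c i = if i == p then c P + c leaf ∸ 1 else c (ι i)

  contract-p : ∀ c → contract c p ≡ c P + c leaf ∸ 1
  contract-p c rewrite ==-refl p = refl

  contract-inner : ∀ c {i} → i ≢ p → contract c i ≡ c (ι i)
  contract-inner c i≢p rewrite ==-≢ i≢p = refl

  contract-cong : ∀ {c d} → c ≗ d → contract c ≗ contract d
  contract-cong c≗d i = cong₂ (λ a b → if i == p then a else b)
                              (cong₂ (λ x y → x + y ∸ 1) (c≗d P) (c≗d leaf)) (c≗d (ι i))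

  charged-contract : ∀ {c} → Charged c → suc (contract c p) ≡ c P + c leaf
  charged-contract {c} (charged chips) = trans (cong suc (contract-p c)) (trans (+-comm 1 _) (m∸n+n≡m chips))

  fire-leaf-P : ∀ c → fire T leaf c P ≡ c P + 1
  fire-leaf-P c = trans (fire-other T c leaf≢ι) (cong (λ b → c P + b2n b) leaf-adjacent)

  fire-leaf-leaf : ∀ c → fire T leaf c leaf ≡ c leaf ∸ 1
  fire-leaf-leaf c = trans (fire-self T leaf c) (cong (c leaf ∸_) leaf-deg)

  fire-leaf-inner : ∀ c {i} → i ≢ p → fire T leaf c (ι i) ≡ c (ι i)
  fire-leaf-inner c {i} i≢p = trans (fire-other T c leaf≢ι)
    (trans (cong (λ b → c (ι i) + b2n b) (trans (symmetric leaf (ι i)) (inner-not-leaf i≢p))) (+-identityʳ _))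

  fire-P-P : ∀ c → fire T P c P ≡ c P ∸ suc (deg H p)
  fire-P-P c = trans (fire-self T P c) (cong (c P ∸_) deg-P)

  fire-P-leaf : ∀ c → fire T P c leaf ≡ c leaf + 1
  fire-P-leaf c = trans (fire-other T c ι≢leaf) (cong (λ b → c leaf + b2n b) P-leaf)

  fire-P-inner : ∀ c {i} → p ≢ i → fire T P c (ι i) ≡ c (ι i) + b2n (H p i)
  fire-P-inner c p≢i = fire-other T c (ι≢ι p≢i)

  fire-inner-leaf : ∀ c {i} → i ≢ p → fire T (ι i) c leaf ≡ c leaf
  fire-inner-leaf c {i} i≢p =
    trans (fire-other T c ι≢leaf) (trans (cong (λ b → c leaf + b2n b) (inner-not-leaf i≢p)) (+-identityʳ _))

  fire-inner-ι : ∀ c {i} → i ≢ p → ∀ j → fire T (ι i) c (ι j) ≡ fire H i (c ∘ ι) j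
  fire-inner-ι c {i} i≢p j rewrite ==-inject₁ i j | deg-inner i≢p = refl

  contract-fire-leaf : ∀ {c} → 1 ≤ c leaf → contract (fire T leaf c) ≗ contract c
  contract-fire-leaf {c} 1≤leaf = split-at p (begin
    contract (fire T leaf c) p                  ≡⟨ contract-p (fire T leaf c) ⟩
    fire T leaf c P + fire T leaf c leaf ∸ 1     ≡⟨ cong₂ (λ a b → a + b ∸ 1) (fire-leaf-P c) (fire-leaf-leaf c) ⟩
    c P + 1 + (c leaf ∸ 1) ∸ 1                   ≡⟨ cong (_∸ 1) (+-assoc (c P) 1 (c leaf ∸ 1)) ⟩
    c P + (1 + (c leaf ∸ 1)) ∸ 1                 ≡⟨ cong (λ x → c P + x ∸ 1) (m+[n∸m]≡n 1≤leaf) ⟩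
    c P + c leaf ∸ 1                             ≡⟨ contract-p c ⟨
    contract c p                                 ∎)
    λ i i≢p → trans (contract-inner (fire T leaf c) i≢p) (trans (fire-leaf-inner c i≢p) (sym (contract-inner c i≢p)))
    where open ≡-Reasoning

  contract-fire-P : ∀ {c} → deg T P ≤ c P → contract (fire T P c) ≗ fire H p (contract c)
  contract-fire-P {c} legal = split-at p (begin
    contract (fire T P c) p                       ≡⟨ contract-p (fire T P c) ⟩
    fire T P c P + fire T P c leaf ∸ 1            ≡⟨ cong₂ (λ a b → a + b ∸ 1) (fire-P-P c) (fire-P-leaf c) ⟩
    c P ∸ suc (deg H p) + (c leaf + 1) ∸ 1        ≡⟨ cong (_∸ 1) (+-assoc (c P ∸ suc (deg H p)) (c leaf) 1) ⟨
    c P ∸ suc (deg H p) + c leaf + 1 ∸ 1          ≡⟨ m+n∸n≡m _ 1 ⟩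
    c P ∸ suc (deg H p) + c leaf                  ≡⟨ +-∸-comm (c leaf) legal′ ⟨
    c P + c leaf ∸ (1 + deg H p)                  ≡⟨ ∸-+-assoc (c P + c leaf) 1 (deg H p) ⟨
    c P + c leaf ∸ 1 ∸ deg H p                    ≡⟨ cong (_∸ deg H p) (contract-p c) ⟨
    contract c p ∸ deg H p                        ≡⟨ fire-self H p (contract c) ⟨
    fire H p (contract c) p                       ∎)
    λ i i≢p → begin
    contract (fire T P c) i                       ≡⟨ contract-inner (fire T P c) i≢p ⟩
    fire T P c (ι i)                              ≡⟨ fire-P-inner c (i≢p ∘ sym) ⟩
    c (ι i) + b2n (H p i)                         ≡⟨ cong (_+ b2n (H p i)) (contract-inner c i≢p) ⟨
    contract c i + b2n (H p i)                    ≡⟨ fire-other H (contract c) (i≢p ∘ sym) ⟨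
    fire H p (contract c) i                       ∎
    where
    open ≡-Reasoning
    legal′ : suc (deg H p) ≤ c P
    legal′ = subst (_≤ c P) deg-P legal

  contract-fire-inner : ∀ {c i} → i ≢ p → Charged c → contract (fire T (ι i) c) ≗ fire H i (contract c)
  contract-fire-inner {c} {i} i≢p (charged chips) = split-at p (begin
    contract (fire T (ι i) c) p                   ≡⟨ contract-p (fire T (ι i) c) ⟩
    fire T (ι i) c P + fire T (ι i) c leaf ∸ 1    ≡⟨ cong₂ (λ a b → a + b ∸ 1) (fire-inner-ι c i≢p p) (fire-inner-leaf c i≢p) ⟩
    fire H i (c ∘ ι) p + c leaf ∸ 1               ≡⟨ cong (λ a → a + c leaf ∸ 1) (fire-other H (c ∘ ι) i≢p) ⟩
    c P + b2n (H i p) + c leaf ∸ 1                ≡⟨ cong (_∸ 1) (+-assoc (c P) (b2n (H i p)) (c leaf)) ⟩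
    c P + (b2n (H i p) + c leaf) ∸ 1              ≡⟨ cong (λ a → c P + a ∸ 1) (+-comm (b2n (H i p)) (c leaf)) ⟩
    c P + (c leaf + b2n (H i p)) ∸ 1              ≡⟨ cong (_∸ 1) (+-assoc (c P) (c leaf) (b2n (H i p))) ⟨
    c P + c leaf + b2n (H i p) ∸ 1                ≡⟨ +-∸-comm (b2n (H i p)) chips ⟩
    c P + c leaf ∸ 1 + b2n (H i p)                ≡⟨ cong (_+ b2n (H i p)) (contract-p c) ⟨
    contract c p + b2n (H i p)                    ≡⟨ fire-other H (contract c) i≢p ⟨
    fire H i (contract c) p                       ∎)
    λ j j≢p → begin
    contract (fire T (ι i) c) j                   ≡⟨ contract-inner (fire T (ι i) c) j≢p ⟩
    fire T (ι i) c (ι j)                          ≡⟨ fire-inner-ι c i≢p j ⟩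
    fire H i (c ∘ ι) j                            ≡⟨ fire-cong H i {contract c} {c ∘ ι} j (contract-inner c j≢p) ⟨
    fire H i (contract c) j                       ∎
    where open ≡-Reasoning

  fire-P-charges : ∀ c → Charged (fire T P c)
  fire-P-charges c = charged $ ≤-trans (≤-trans (m≤n+m 1 (c leaf)) (≤-reflexive (sym (fire-P-leaf c)))) (m≤n+m _ _)

  fire-leaf-charges : ∀ c → Charged (fire T leaf c)
  fire-leaf-charges c = charged $ ≤-trans (≤-trans (m≤n+m 1 (c P)) (≤-reflexive (sym (fire-leaf-P c)))) (m≤m+n _ _)

  fire-keeps-charged : ∀ {c} j → Charged c → Charged (fire T j c)
  fire-keeps-charged {c} j c-charged@(charged chips) with view j
  ... | ‵fromℕ = fire-leaf-charges c
  ... | ‵inj₁ {i = i} _ with i ≟ p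
  ...   | yes refl = fire-P-charges c
  ...   | no  i≢p  = charged (≤-trans chips (+-mono-≤ P-grows (≤-reflexive (sym (fire-inner-leaf c i≢p)))))
    where
    P-grows : c P ≤ fire T (ι i) c P
    P-grows = ≤-trans (m≤m+n (c P) _) (≤-reflexive (sym (fire-other T c (ι≢ι i≢p))))

  runs-keep-charged : ∀ {c is d} → Runs T c is d → Charged c → Charged d
  runs-keep-charged (done c≗d)         (charged chips) = charged (subst (1 ≤_) (cong₂ _+_ (c≗d P) (c≗d leaf)) chips)
  runs-keep-charged (step {i = j} _ r) c-charged      = runs-keep-charged r (fire-keeps-charged j c-charged)

  runs-through-P-charged : ∀ {c is d} → Runs T c is d → P ∈ is → Charged d
  runs-through-P-charged (step {c = c} _ r) (here refl) = runs-keep-charged r (fire-P-charges c)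
  runs-through-P-charged (step _ r)         (there P∈is) = runs-through-P-charged r P∈is

  contract-runs : ∀ {c is d} → Runs T c is d → Charged c →
                  ∃ λ is′ → Runs H (contract c) is′ (contract d) × (P ∈ is → p ∈ is′)
  contract-runs (done c≗d) _ = [] , done (contract-cong c≗d) , λ ()
  contract-runs {c} (step {i = j} legal r) c-charged with view j
  ... | ‵fromℕ =
    let is′ , r′ , p∈is′ = contract-runs r (fire-leaf-charges c)
    in is′ , runs-cong H (contract-fire-leaf {c} 1≤leaf) (λ _ → refl) r′ ,
       λ { (here P≡leaf) → contradiction (sym P≡leaf) leaf≢ι ; (there P∈is) → p∈is′ P∈is }
    where
    1≤leaf : 1 ≤ c leaf
    1≤leaf = subst (_≤ c leaf) leaf-deg legal
  ... | ‵inj₁ {i = i} _ with i ≟ p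
  ...   | yes refl =
    let is′ , r′ , _ = contract-runs r (fire-P-charges c)
    in p ∷ is′ , step legal′ (runs-cong H (contract-fire-P {c} legal) (λ _ → refl) r′) , λ _ → here refl
    where
    legal′ : deg H p ≤ contract c p
    legal′ = ≤-pred (≤-trans (subst (_≤ c P) deg-P legal)
                             (≤-trans (m≤m+n (c P) (c leaf)) (≤-reflexive (sym (charged-contract c-charged)))))
  ...   | no i≢p =
    let is′ , r′ , p∈is′ = contract-runs r (fire-keeps-charged (ι i) c-charged)
    in i ∷ is′ , step legal′ (runs-cong H (contract-fire-inner i≢p c-charged) (λ _ → refl) r′) ,
       λ { (here P≡ιi)  → contradiction (sym (inject₁-injective P≡ιi)) i≢p
         ; (there P∈is) → there (p∈is′ P∈is) }
    where
    legal′ : deg H i ≤ contract c i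
    legal′ = subst₂ _≤_ (deg-inner i≢p) (sym (contract-inner c i≢p)) legal

  selfReachable-contract : ∀ {c} → SelfReachable T c → Charged c × SelfReachable H (contract c)
  selfReachable-contract {c} (j , is , r) = c-charged , from-loop (contract-runs r c-charged)
    where
    P∈loop : P ∈ j ∷ is
    P∈loop = selfLoop-fires-all symmetric connected r P
    c-charged : Charged c
    c-charged = runs-through-P-charged r P∈loop
    from-loop : (∃ λ is′ → Runs H (contract c) is′ (contract c) × (P ∈ j ∷ is → p ∈ is′)) →
                SelfReachable H (contract c)
    from-loop ([] , _ , p∈[])     with () ← p∈[] P∈loop
    from-loop (i ∷ is′ , r′ , _) = i , is′ , r′

  contract-injective : ∀ {c d} → Charged c → Charged d → c leaf ≡ d leaf → contract c ≗ contract d → c ≗ d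
  contract-injective {c} {d} c-charged d-charged leaf≡ contract≗ w with view w
  ... | ‵fromℕ = leaf≡
  ... | ‵inj₁ {i = i} _ with i ≟ p
  ...   | yes refl = +-cancelʳ-≡ (c leaf) (c P) (d P) (begin
    c P + c leaf         ≡⟨ charged-contract c-charged ⟨
    suc (contract c p)   ≡⟨ cong suc (contract≗ p) ⟩
    suc (contract d p)   ≡⟨ charged-contract d-charged ⟩
    d P + d leaf         ≡⟨ cong (d P +_) leaf≡ ⟨
    d P + c leaf         ∎)
    where open ≡-Reasoning
  ...   | no  i≢p  = trans (sym (contract-inner c i≢p)) (trans (contract≗ i) (contract-inner d i≢p))

  -- Firing p in H is simulated by firing the leaf and then P if the leaf holds its chip,
  -- and by firing P and then the leaf otherwise; either way the leaf ends as it started.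
  lift-fire-p : ∀ {c} → Charged c → c leaf ≤ 1 → deg H p ≤ contract c p →
                ∃₂ λ j j′ → deg T j ≤ c j × deg T j′ ≤ fire T j c j′ ×
                            Charged (fire T j′ (fire T j c)) ×
                            contract (fire T j′ (fire T j c)) ≗ fire H p (contract c) ×
                            fire T j′ (fire T j c) leaf ≡ c leaf
  lift-fire-p {c} c-charged leaf≤1 legal with n≤1⇒n≡0∨n≡1 leaf≤1
  ... | inj₂ leaf≡1 =
    leaf , P , ≤-reflexive (trans leaf-deg (sym leaf≡1)) , legal₂ , fire-P-charges c₁ ,
    (λ i → trans (contract-fire-P {c₁} legal₂ i)
                 (fire-cong H p {contract c₁} {contract c} i (contract-fire-leaf {c} 1≤leaf i))) ,
    trans (fire-P-leaf c₁) (trans (cong (_+ 1) (trans (fire-leaf-leaf c) (cong (_∸ 1) leaf≡1))) (sym leaf≡1))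
    where
    c₁ : Config (suc (suc k))
    c₁ = fire T leaf c
    1≤leaf : 1 ≤ c leaf
    1≤leaf = ≤-reflexive (sym leaf≡1)
    legal₂ : deg T P ≤ c₁ P
    legal₂ = subst₂ _≤_ (sym deg-P) (trans (cong (c P +_) leaf≡1) (sym (fire-leaf-P c)))
                        (≤-trans (s≤s legal) (≤-reflexive (charged-contract c-charged)))
  ... | inj₁ leaf≡0 =
    P , leaf , legal₁ , ≤-reflexive (trans leaf-deg (sym (trans (fire-P-leaf c) (cong (_+ 1) leaf≡0)))) ,
    fire-leaf-charges c₁ ,
    (λ i → trans (contract-fire-leaf {c₁} 1≤leaf₁ i) (contract-fire-P {c} legal₁ i)) ,
    trans (fire-leaf-leaf c₁) (trans (cong (_∸ 1) (trans (fire-P-leaf c) (cong (_+ 1) leaf≡0))) (sym leaf≡0))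
    where
    c₁ : Config (suc (suc k))
    c₁ = fire T P c
    legal₁ : deg T P ≤ c P
    legal₁ = subst₂ _≤_ (sym deg-P) (trans (cong (c P +_) leaf≡0) (+-identityʳ (c P)))
                        (≤-trans (s≤s legal) (≤-reflexive (charged-contract c-charged)))
    1≤leaf₁ : 1 ≤ c₁ leaf
    1≤leaf₁ = ≤-trans (m≤n+m 1 (c leaf)) (≤-reflexive (sym (fire-P-leaf c)))

  lift-runs : ∀ {x y is} → Runs H x is y → ∀ {c d} → Charged c → contract c ≗ x → c leaf ≤ 1 →
              Charged d → contract d ≗ y → d leaf ≡ c leaf → ∃ λ js → Runs T c js d × length is ≤ length js
  lift-runs (done x≗y) {c} {d} c-charged c≗x _ d-charged d≗y leaf≡ =
    [] , done (contract-injective c-charged d-charged (sym leaf≡) c≗d) , z≤n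
    where
    c≗d : contract c ≗ contract d
    c≗d i = trans (c≗x i) (trans (x≗y i) (sym (d≗y i)))
  lift-runs {x} (step {i = i} legal r) {c} c-charged c≗x leaf≤1 d-charged d≗y leaf≡ with i ≟ p
  ... | yes refl =
    let j , j′ , legal₁ , legal₂ , c′-charged , c′≗ , leaf-kept =
          lift-fire-p c-charged leaf≤1 (subst (deg H p ≤_) (sym (c≗x p)) legal)
        js , r′ , len = lift-runs r c′-charged (λ i → trans (c′≗ i) (fire-cong H p {contract c} {x} i (c≗x i)))
                                  (subst (_≤ 1) (sym leaf-kept) leaf≤1) d-charged d≗y (trans leaf≡ (sym leaf-kept))
    in j ∷ j′ ∷ js , step legal₁ (step legal₂ r′) , s≤s (m≤n⇒m≤1+n len)
  ... | no i≢p =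
    let js , r′ , len = lift-runs r (fire-keeps-charged (ι i) c-charged) c′≗ (subst (_≤ 1) (sym leaf-kept) leaf≤1)
                                  d-charged d≗y (trans leaf≡ (sym leaf-kept))
    in ι i ∷ js , step legal′ r′ , s≤s len
    where
    leaf-kept : fire T (ι i) c leaf ≡ c leaf
    leaf-kept = fire-inner-leaf c i≢p
    c′≗ : contract (fire T (ι i) c) ≗ fire H i x
    c′≗ j = trans (contract-fire-inner i≢p c-charged j) (fire-cong H i {contract c} {x} j (c≗x j))
    legal′ : deg T (ι i) ≤ c (ι i)
    legal′ = subst₂ _≤_ (sym (deg-inner i≢p)) (trans (sym (c≗x i)) (contract-inner c i≢p)) legal

  selfReachable-lift : ∀ {c} → Charged c → c leaf ≤ 1 → SelfReachable H (contract c) → SelfReachable T c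
  selfReachable-lift c-charged leaf≤1 (i , is , r)
    with lift-runs r c-charged (λ _ → refl) leaf≤1 c-charged (λ _ → refl) refl
  ... | j ∷ js , r′ , _ = j , js , r′

  minusE-ι : ∀ c a i → minusE c (ι a) (ι i) ≡ minusE (c ∘ ι) a i
  minusE-ι c a i rewrite ==-inject₁ a i = refl

  contract-minusE-away : ∀ c a {i} → i ≢ p → contract (minusE c (ι a)) i ≡ minusE (contract c) a i
  contract-minusE-away c a {i} i≢p = begin
    contract (minusE c (ι a)) i    ≡⟨ contract-inner (minusE c (ι a)) i≢p ⟩
    minusE c (ι a) (ι i)           ≡⟨ minusE-ι c a i ⟩
    minusE (c ∘ ι) a i             ≡⟨ minusE-cong {c = contract c} {c ∘ ι} a i (contract-inner c i≢p) ⟨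
    minusE (contract c) a i        ∎
    where open ≡-Reasoning

  contract-minusE-leaf : ∀ {c} → 1 ≤ c leaf → contract (minusE c leaf) ≗ minusE (contract c) p
  contract-minusE-leaf {c} 1≤leaf = split-at p (begin
    contract (minusE c leaf) p                 ≡⟨ contract-p (minusE c leaf) ⟩
    minusE c leaf P + minusE c leaf leaf ∸ 1   ≡⟨ cong₂ (λ a b → a + b ∸ 1) (minusE-other c leaf≢ι) (minusE-self c leaf) ⟩
    c P + (c leaf ∸ 1) ∸ 1                     ≡⟨ cong (_∸ 1) (+-∸-assoc (c P) 1≤leaf) ⟨
    c P + c leaf ∸ 1 ∸ 1                       ≡⟨ cong (_∸ 1) (contract-p c) ⟨
    contract c p ∸ 1                           ≡⟨ minusE-self (contract c) p ⟨
    minusE (contract c) p p                    ∎)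
    λ i i≢p → begin
    contract (minusE c leaf) i                 ≡⟨ contract-inner (minusE c leaf) i≢p ⟩
    minusE c leaf (ι i)                        ≡⟨ minusE-other c leaf≢ι ⟩
    c (ι i)                                    ≡⟨ contract-inner c i≢p ⟨
    contract c i                               ≡⟨ minusE-other (contract c) (i≢p ∘ sym) ⟨
    minusE (contract c) p i                    ∎
    where open ≡-Reasoning

  contract-minusE-P : ∀ {c} → 1 ≤ c P → contract (minusE c P) ≗ minusE (contract c) p
  contract-minusE-P {c} 1≤cP = split-at p (begin
    contract (minusE c P) p                    ≡⟨ contract-p (minusE c P) ⟩
    minusE c P P + minusE c P leaf ∸ 1         ≡⟨ cong₂ (λ a b → a + b ∸ 1) (minusE-self c P) (minusE-other c (ι≢leaf {p})) ⟩
    c P ∸ 1 + c leaf ∸ 1                       ≡⟨ cong (_∸ 1) (+-∸-comm (c leaf) 1≤cP) ⟨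
    c P + c leaf ∸ 1 ∸ 1                       ≡⟨ cong (_∸ 1) (contract-p c) ⟨
    contract c p ∸ 1                           ≡⟨ minusE-self (contract c) p ⟨
    minusE (contract c) p p                    ∎)
    λ i → contract-minusE-away c p
    where open ≡-Reasoning

  contract-minusE-inner : ∀ {c a} → a ≢ p → contract (minusE c (ι a)) ≗ minusE (contract c) a
  contract-minusE-inner {c} {a} a≢p = split-at p (begin
    contract (minusE c (ι a)) p                ≡⟨ contract-p (minusE c (ι a)) ⟩
    minusE c (ι a) P + minusE c (ι a) leaf ∸ 1 ≡⟨ cong₂ (λ a b → a + b ∸ 1) (minusE-other c (ι≢ι a≢p)) (minusE-other c (ι≢leaf {a})) ⟩
    c P + c leaf ∸ 1                           ≡⟨ contract-p c ⟨
    contract c p                               ≡⟨ minusE-other (contract c) a≢p ⟨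
    minusE (contract c) a p                    ∎)
    λ i → contract-minusE-away c a
    where open ≡-Reasoning

  contract-minusE-ι : ∀ {c} a → Dec (a ≡ p) → 1 ≤ c (ι a) → contract (minusE c (ι a)) ≗ minusE (contract c) a
  contract-minusE-ι {c} _ (yes refl) 1≤cP = contract-minusE-P {c} 1≤cP
  contract-minusE-ι {c} a (no a≢p)   _    = contract-minusE-inner {c} a≢p

  decSR-contract-ι : ∀ {c} a → Dec (a ≡ p) → DecSR T c (ι a) → DecSR H (contract c) a
  decSR-contract-ι {c} a a≟p (1≤ca , sr) with selfReachable-contract sr
  ... | charged chips , srH = positive a≟p , selfReachable-cong H (contract-minusE-ι {c} a a≟p 1≤ca) srH
    where
    positive : Dec (a ≡ p) → 1 ≤ contract c a
    positive (no a≢p)   = subst (1 ≤_) (sym (contract-inner c a≢p)) 1≤ca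
    positive (yes refl) = subst (1 ≤_) (begin
      minusE c P P + minusE c P leaf   ≡⟨ cong₂ _+_ (minusE-self c P) (minusE-other c (ι≢leaf {p})) ⟩
      c P ∸ 1 + c leaf                 ≡⟨ +-∸-comm (c leaf) 1≤ca ⟨
      c P + c leaf ∸ 1                 ≡⟨ contract-p c ⟨
      contract c p                     ∎) chips
      where open ≡-Reasoning

  decSR-contract : ∀ {c} j → DecSR T c j → DecSR H (contract c) (pinch p j)
  decSR-contract {c} j dec with view j
  ... | ‵inj₁ {i = a} _ rewrite pinch-inject₁ a = decSR-contract-ι a (a ≟ p) dec
  ... | ‵fromℕ rewrite pinch-fromℕ k with dec
  ...   | 1≤leaf , sr with selfReachable-contract sr
  ...     | charged chips , srH = pos , selfReachable-cong H (contract-minusE-leaf {c} 1≤leaf) srH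
    where
    pos : 1 ≤ contract c p
    pos = subst (1 ≤_) (begin
      minusE c leaf P + minusE c leaf leaf   ≡⟨ cong₂ _+_ (minusE-other c leaf≢ι) (minusE-self c leaf) ⟩
      c P + (c leaf ∸ 1)                     ≡⟨ +-∸-assoc (c P) 1≤leaf ⟨
      c P + c leaf ∸ 1                       ≡⟨ contract-p c ⟨
      contract c p                           ∎) chips
      where open ≡-Reasoning

  contract-snoc-p : ∀ x b → contract (snoc x b) p ≡ x p + b ∸ 1
  contract-snoc-p x b = trans (contract-p (snoc x b)) (cong₂ (λ a b → a + b ∸ 1) (snoc-inject₁ x b p) (snoc-fromℕ x b))

  contract-snoc-inner : ∀ x b {i} → i ≢ p → contract (snoc x b) i ≡ x i
  contract-snoc-inner x b {i} i≢p = trans (contract-inner (snoc x b) i≢p) (snoc-inject₁ x b i)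

  not-minimal : ∀ {c} → suc k < total c → ¬ MinSelfReachable T c
  not-minimal k<total (_ , total≡) = <⇒≢ (s≤s k<total) (sym total≡)

  decSR-lift : ∀ {c a} → c leaf ≤ 1 → 1 ≤ c (ι a) → Charged (minusE c (ι a)) →
               SelfReachable H (minusE (contract c) a) → DecSR T c (ι a)
  decSR-lift {c} {a} leaf≤1 1≤ca charged′ sr =
    1≤ca , selfReachable-lift charged′ (subst (_≤ 1) (sym (minusE-other c (ι≢leaf {a}))) leaf≤1)
                              (selfReachable-cong H (sym ∘ contract-minusE-ι {c} a (a ≟ p) 1≤ca) sr)

  nearMin-snoc : ∀ {ν t x b} → t ≢ p → NearMinSRAbout H ν t → b ≤ 1 → x p + b ≡ suc (ν p) →
                 (∀ i → i ≢ p → x i ≡ ν i) → suc k < total (snoc x b) → NearMinSRAbout T (snoc x b) (ι t)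
  nearMin-snoc {ν} {t} {x} {b} t≢p (srν , _ , (1≤νt , srνt) , unique) b≤1 pair≡ x≗ν k<total =
    selfReachable-lift c-charged leaf≤1 (selfReachable-cong H (sym ∘ c≗ν) srν) ,
    not-minimal k<total ,
    decSR-lift {c} {t} leaf≤1 1≤ct charged′
               (selfReachable-cong H (λ j → minusE-cong {c = ν} {contract c} t j (sym (c≗ν j))) srνt) ,
    unique′
    where
    c : Config (suc (suc k))
    c = snoc x b
    pair : c P + c leaf ≡ suc (ν p)
    pair = trans (cong₂ _+_ (snoc-inject₁ x b p) (snoc-fromℕ x b)) pair≡
    c-charged : Charged c
    c-charged = charged (≤-trans (s≤s z≤n) (≤-reflexive (sym pair)))
    leaf≤1 : c leaf ≤ 1
    leaf≤1 = subst (_≤ 1) (sym (snoc-fromℕ x b)) b≤1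
    c≗ν : contract c ≗ ν
    c≗ν = split-at p (trans (contract-p c) (cong (_∸ 1) pair))
                     (λ i i≢p → trans (contract-snoc-inner x b i≢p) (x≗ν i i≢p))
    1≤ct : 1 ≤ c (ι t)
    1≤ct = subst (1 ≤_) (trans (sym (c≗ν t)) (contract-inner c t≢p)) 1≤νt
    charged′ : Charged (minusE c (ι t))
    charged′ = charged (subst (1 ≤_) (sym (cong₂ _+_ (minusE-other c (ι≢ι t≢p)) (minusE-other c (ι≢leaf {t}))))
                              (Charged.chips c-charged))
    unique′ : ∀ j → DecSR T c j → j ≡ ι t
    unique′ j dec with unique (pinch p j) (decSR-cong c≗ν (decSR-contract {c} j dec)) | view j
    ... | pinch≡t | ‵fromℕ          = contradiction (trans (sym (pinch-fromℕ k)) pinch≡t) (t≢p ∘ sym)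
    ... | pinch≡t | ‵inj₁ {i = a} _ = cong ι (trans (sym (pinch-inject₁ a)) pinch≡t)

  -- A decrease at a ≠ p would, through the patch lemma, give a decrease of ν at a.
  snoc-p-unique : ∀ {ν x} → NearMinSRAbout H ν p → (∀ i → i ≢ p → x i ≡ ν i) →
                  ∀ j → DecSR T (snoc x 0) j → j ≡ P
  snoc-p-unique {ν} {x} (_ , _ , (1≤νp , srνp) , unique) x≗ν j dec with view j
  ... | ‵fromℕ          = contradiction (subst (1 ≤_) (snoc-fromℕ x 0) (proj₁ dec)) λ ()
  ... | ‵inj₁ {i = a} _ = inner a (a ≟ p) (subst (DecSR H (contract c)) (pinch-inject₁ a) (decSR-contract {c} (ι a) dec))
    where
    c : Config (suc (suc k))
    c = snoc x 0
    contract-c-inner : ∀ {i} → i ≢ p → contract c i ≡ ν i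
    contract-c-inner i≢p = trans (contract-snoc-inner x 0 i≢p) (x≗ν _ i≢p)
    νp-1<νp : ν p ∸ 1 < ν p
    νp-1<νp = ≤-reflexive (trans (+-comm 1 _) (m∸n+n≡m 1≤νp))
    inner : ∀ a → Dec (a ≡ p) → DecSR H (contract c) a → ι a ≡ P
    inner _ (yes refl) _           = refl
    inner a (no a≢p)   (1≤ca , sr) = contradiction (unique a (1≤νa , srνa)) a≢p
      where
      1≤νa : 1 ≤ ν a
      1≤νa = subst (1 ≤_) (contract-c-inner a≢p) 1≤ca
      srνa : SelfReachable H (minusE ν a)
      srνa = selfReachable-patch H-isTree {a} {p} {minusE (contract c) a} {minusE ν p} {minusE ν a} sr srνp
               (λ u u≢p → ≤-reflexive (minusE-cong {c = contract c} {ν} a u (contract-c-inner u≢p)))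
               (λ u u≢a u≢p → ≤-reflexive (trans (minusE-other ν (u≢p ∘ sym))
                                                  (sym (minusE-other ν (u≢a ∘ sym)))))
               (subst₂ _<_ (sym (minusE-self ν p)) (sym (minusE-other ν a≢p)) νp-1<νp)

  nearMin-snoc-p : ∀ {ν x} → NearMinSRAbout H ν p → ν p < x p → (∀ i → i ≢ p → x i ≡ ν i) →
                   suc k < total (snoc x 0) → NearMinSRAbout T (snoc x 0) P
  nearMin-snoc-p {ν} {x} nearMin@(srν , _ , (1≤νp , srνp) , _) νp<xp x≗ν k<total =
    selfReachable-lift c-charged leaf≤1 (selfReachable-mono H srν ν≤) ,
    not-minimal k<total ,
    decSR-lift {c} {p} leaf≤1 1≤cP charged′ (selfReachable-mono H srνp (minusE-mono {q = p} ν≤)) ,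
    snoc-p-unique nearMin x≗ν
    where
    c : Config (suc (suc k))
    c = snoc x 0
    cP : c P ≡ x p
    cP = snoc-inject₁ x 0 p
    c-leaf : c leaf ≡ 0
    c-leaf = snoc-fromℕ x 0
    leaf≤1 : c leaf ≤ 1
    leaf≤1 = subst (_≤ 1) (sym c-leaf) z≤n
    νp≤ : ν p ≤ x p ∸ 1
    νp≤ = ∸-monoˡ-≤ 1 νp<xp
    ν≤ : ∀ i → ν i ≤ contract c i
    ν≤ = split-at p (≤-trans νp≤ (≤-reflexive (sym (trans (contract-snoc-p x 0) (cong (_∸ 1) (+-identityʳ (x p)))))))
                    (λ i i≢p → ≤-reflexive (sym (trans (contract-snoc-inner x 0 i≢p) (x≗ν i i≢p))))
    1≤cP : 1 ≤ c P
    1≤cP = subst (1 ≤_) (sym cP) (≤-trans (s≤s z≤n) νp<xp)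
    c-charged : Charged c
    c-charged = charged (≤-trans 1≤cP (m≤m+n (c P) (c leaf)))
    charged′ : Charged (minusE c P)
    charged′ = charged (≤-trans (≤-trans 1≤νp νp≤) (≤-reflexive (sym (begin
      minusE c P P + minusE c P leaf   ≡⟨ cong₂ _+_ (minusE-self c P) (minusE-other c (ι≢leaf {p})) ⟩
      c P ∸ 1 + c leaf                 ≡⟨ cong₂ (λ a b → a ∸ 1 + b) cP c-leaf ⟩
      x p ∸ 1 + 0                      ≡⟨ +-identityʳ _ ⟩
      x p ∸ 1                          ∎))))
      where open ≡-Reasoning

lemma5p7 : (k : ℕ) (T : Graph (suc (suc k))) → IsTree T
    → T (fromℕ (suc k)) (inject₁ (fromℕ k)) ≡ true
    → deg T (fromℕ (suc k)) ≡ 1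
    → (t : Fin (suc k)) (ℓ : ℕ) → suc (suc k) ≤ ℓ
    → (ν : Config (suc k)) → NearMinSRAbout (deleteLast T) ν t → total ν ≡ ℓ
    → (t ≢ fromℕ k →
          (NearMinSRAbout T (snoc (plusE ν (fromℕ k) 1) 0) (inject₁ t)
            × total (snoc (plusE ν (fromℕ k) 1) 0) ≡ ℓ + 1)
        × (NearMinSRAbout T (snoc ν 1) (inject₁ t)
            × total (snoc ν 1) ≡ ℓ + 1))
    × (t ≡ fromℕ k → (L : ℕ) → 1 ≤ L →
          NearMinSRAbout T (snoc (plusE ν (fromℕ k) L) 0) (inject₁ t)
            × total (snoc (plusE ν (fromℕ k) L) 0) ≡ ℓ + L)
lemma5p7 k T tree leaf-adjacent leaf-deg t ℓ n≤ℓ ν nearMin total≡ℓ =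
  (λ t≢p → (nearMin-snoc t≢p nearMin z≤n νp+1 ν+e≗ν (large-plus 1) , total-plus 1) ,
           (nearMin-snoc t≢p nearMin ≤-refl (+-comm (ν p) 1) (λ _ _ → refl) large-leaf , total-leaf)) ,
  (λ { refl L 1≤L → nearMin-snoc-p nearMin (νp<νp+L 1≤L) ν+e≗ν (large-plus L) , total-plus L })
  where
  open LeafContraction tree leaf-adjacent leaf-deg
  total-plus : ∀ L → total (snoc (plusE ν p L) 0) ≡ ℓ + L
  total-plus L = trans (total-snoc (plusE ν p L) 0)
                       (trans (+-identityʳ _) (trans (total-plusE ν p L) (cong (_+ L) total≡ℓ)))
  total-leaf : total (snoc ν 1) ≡ ℓ + 1
  total-leaf = trans (total-snoc ν 1) (cong (_+ 1) total≡ℓ)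
  large-plus : ∀ L → suc k < total (snoc (plusE ν p L) 0)
  large-plus L = subst (suc k <_) (sym (total-plus L)) (≤-trans n≤ℓ (m≤m+n ℓ L))
  large-leaf : suc k < total (snoc ν 1)
  large-leaf = subst (suc k <_) (sym total-leaf) (≤-trans n≤ℓ (m≤m+n ℓ 1))
  νp+1 : plusE ν p 1 p + 0 ≡ suc (ν p)
  νp+1 = trans (+-identityʳ _) (trans (plusE-self ν p 1) (+-comm (ν p) 1))
  ν+e≗ν : ∀ {L} i → i ≢ p → plusE ν p L i ≡ ν i
  ν+e≗ν i i≢p = plusE-other ν _ (i≢p ∘ sym)
  νp<νp+L : ∀ {L} → 1 ≤ L → ν p < plusE ν p L p
  νp<νp+L {L} 1≤L = subst₂ _≤_ (+-comm (ν p) 1) (sym (plusE-self ν p L)) (+-monoʳ-≤ (ν p) 1≤L)
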